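{- Let $e$ be a normal expression of the split fireball calculus. Then there exists a tight derivation $\pi\triangleright\Gamma\vdash e:\mathbf 0$. Moreover, $e$ is a value or a coerced value if and only if $\pi$ is empty (i.e. $\mathrm{dom}(\Gamma)=\emptyset$).
   Context: Terms: $t,u ::= x \mid \lambda x.t \mid tu$, up to $\alpha$-equivalence; $t\{x\leftarrow u\}$ is capture-avoiding substitution. Values: $v ::= x \mid \lambda x.t$. Fireballs $f$ and inert terms $i$ are defined by mutual induction: $f ::= v \mid i$ and $i ::= x f_1 \dots f_n$ with $n>0$ (application left-associative). Right evaluation contexts: $C ::= \langle\cdot\rangle \mid t\,C \mid C\,f$. Split fireball calculus: environments $E ::= \epsilon \mid [x\leftarrow i]:E$; programs $p=(t,E)$; expressions are terms or programs; a coerced value is a program $(v,\epsilon)$. Reduction: $(C\langle(\lambda x.t)v\rangle,E)\to_{\beta_v}(C\langle t\{x\leftarrow v\}\rangle,E)$ and $(C\langle(\lambda x.t)i\rangle,E)\to_{\beta_i}(C\langle t\rangle,[x\leftarrow i]:E)$; $\to_{\beta_f}=\to_{\beta_v}\cup\to_{\beta_i}$. A program is normal if it has no $\to_{\beta_f}$-reduct; a normal expression is a normal program or a term $t$ such that $(t,E)$ is normal for every environment $E$. Append: $\epsilon@[x\leftarrow i]=[x\leftarrow i]$, $([y\leftarrow i']:E)@[x\leftarrow i]=[y\leftarrow i']:(E@[x\leftarrow i])$. Multi types: linear types $L ::= M\multimap N$; multi types $M,N ::= [L_1,\dots,L_n]$ (finite multisets, $n\ge 0$); $\mathbf 0$ empty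 multiset, $\uplus$ multiset sum. Type context $\Gamma$: total map from variables to multi types with finite $\mathrm{dom}(\Gamma)=\{x\mid \Gamma(x)\ne\mathbf 0\}$; $(\Gamma\uplus\Delta)(x)=\Gamma(x)\uplus\Delta(x)$; $x:M$ maps $x$ to $M$ and all else to $\mathbf 0$; $\Gamma,x:M$ extends $\Gamma$ ($x\notin\mathrm{dom}(\Gamma)$) by $x\mapsto M$. Typing rules: (ax) $x:M\vdash x:M$; (@) from $\Gamma\vdash t:[M\multimap N]$ and $\Delta\vdash u:M$ infer $\Gamma\uplus\Delta\vdash tu:N$; ($\lambda$) from $\Gamma_k,x:M_k\vdash t:N_k$ for $k=1,\dots,n$ ($n\ge0$) infer $\Gamma_1\uplus\dots\uplus\Gamma_n\vdash\lambda x.t:[M_1\multimap N_1,\dots,M_n\multimap N_n]$; (es$_\epsilon$) from $\Gamma\vdash t:M$ infer $\Gamma\vdash (t,\epsilon):M$; (es$_@$) from $\Gamma,x:M\vdash(t,E):N$ and $\Delta\vdash i:M$ infer $\Gamma\uplus\Delta\vdash(t,E@[x\leftarrow i]):N$. Inert multi types: finite multisets of linear types $\mathbf 0\multimap N$ with $N$ inert (inductively; $\mathbf 0$ is inert); a context is inert if all its values are inert. A derivation $\pi\triangleright\Gamma\vdash e:M$ is inert if $\Gamma$ and $M$ are inert; tight if it is inert and $M=\mathbf 0$; empty if $\mathrm{dom}(\Gamma)=\emptyset$ and nonempty otherwise. -}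

module Defs where

open import Data.Nat using (ℕ; zero; suc)
open import Data.Fin using (Fin; zero; suc)
open import Data.List using (List; []; _∷_; _++_)
open import Data.Vec using (Vec; lookup; zipWith; replicate; _[_]≔_) renaming (_∷_ to _∷ᵥ_)
open import Data.Product using (Σ; _×_; _,_)
open import Data.Sum using (_⊎_; inj₁; inj₂)
open import Relation.Nullary using (¬_)
open import Relation.Binary.PropositionalEquality using (_≡_)

-- Terms, with de Bruijn indices (so α-equivalence is syntactic equality).
-- Term n = terms whose free variables are among n variables.

data Term (n : ℕ) : Set where
  var : Fin n → Term n
  lam : Term (suc n) → Term n
  app : Term n → Term n → Term n

ext : ∀ {n m} → (Fin n → Fin m) → Fin (suc n) → Fin (suc m)
ext ρ zero    = zero
ext ρ (suc x) = suc (ρ x)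

rename : ∀ {n m} → (Fin n → Fin m) → Term n → Term m
rename ρ (var x)   = var (ρ x)
rename ρ (lam t)   = lam (rename (ext ρ) t)
rename ρ (app t u) = app (rename ρ t) (rename ρ u)

exts : ∀ {n m} → (Fin n → Term m) → Fin (suc n) → Term (suc m)
exts σ zero    = var zero
exts σ (suc x) = rename suc (σ x)

subst : ∀ {n m} → (Fin n → Term m) → Term n → Term m
subst σ (var x)   = σ x
subst σ (lam t)   = lam (subst (exts σ) t)
subst σ (app t u) = app (subst σ t) (subst σ u)

-- t {x ← u}, x being the bound variable (index 0)
_[_] : ∀ {n} → Term (suc n) → Term n → Term n
t [ u ] = subst σ t
  where
  σ : Fin (suc _) → Term _
  σ zero    = u
  σ (suc x) = var x

data Val {n} : Term n → Set where
  var : (x : Fin n) → Val (var x)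
  lam : (t : Term (suc n)) → Val (lam t)

mutual
  data Fire {n} : Term n → Set where
    val   : ∀ {t} → Val t → Fire t
    inert : ∀ {t} → Inert t → Fire t

  data Inert {n} : Term n → Set where
    head : ∀ (x : Fin n) {f} → Fire f → Inert (app (var x) f)
    more : ∀ {i f} → Inert i → Fire f → Inert (app i f)

data ECtx (n : ℕ) : Set where
  hole : ECtx n
  appL : Term n → ECtx n → ECtx n
  appR : ECtx n → Term n → ECtx n

data RightCtx {n} : ECtx n → Set where
  hole : RightCtx hole
  appL : ∀ t {C} → RightCtx C → RightCtx (appL t C)
  appR : ∀ {C f} → RightCtx C → Fire f → RightCtx (appR C f)

plug : ∀ {n} → ECtx n → Term n → Term n
plug hole       s = s
plug (appL t C) s = app t (plug C s)
plug (appR C f) s = app (plug C s) f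

renameCtx : ∀ {n m} → (Fin n → Fin m) → ECtx n → ECtx m
renameCtx ρ hole       = hole
renameCtx ρ (appL t C) = appL (rename ρ t) (renameCtx ρ C)
renameCtx ρ (appR C f) = appR (renameCtx ρ C) (rename ρ f)

-- Env n m : an environment whose entries may mention the
-- n outer variables, and which binds (m - n) variables, so that the term
-- of a program (t , E) lives in Term m.
-- [x ← i] : E  is  cons i p E  (x is the newest binding, index 0).

data Env (n : ℕ) : ℕ → Set where
  ε    : Env n n
  cons : ∀ {m} (i : Term m) → Inert i → Env n m → Env n (suc m)

-- append  E @ [x ← i]  (x becomes the outermost binding)
_++ₑ[_,_] : ∀ {n m} → Env (suc n) m → (i : Term n) → Inert i → Env n m
ε            ++ₑ[ i , p ] = cons i p ε
cons i' p' E ++ₑ[ i , p ] = cons i' p' (E ++ₑ[ i , p ])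

data Prog (n : ℕ) : Set where
  ⟨_,_⟩ : ∀ {m} → Term m → Env n m → Prog n

Expr : ℕ → Set
Expr n = Term n ⊎ Prog n

data _⟶βv_ {n} : Prog n → Prog n → Set where
  βv : ∀ {m} {C : ECtx m} {t : Term (suc m)} {v : Term m} {E : Env n m} →
       RightCtx C → Val v →
       ⟨ plug C (app (lam t) v) , E ⟩ ⟶βv ⟨ plug C (t [ v ]) , E ⟩

data _⟶βi_ {n} : Prog n → Prog n → Set where
  βi : ∀ {m} {C : ECtx m} {t : Term (suc m)} {i : Term m} {E : Env n m} →
       RightCtx C → (p : Inert i) →
       ⟨ plug C (app (lam t) i) , E ⟩ ⟶βi ⟨ plug (renameCtx suc C) t , cons i p E ⟩

_⟶βf_ : ∀ {n} → Prog n → Prog n → Set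
p ⟶βf q = (p ⟶βv q) ⊎ (p ⟶βi q)

NormalProg : ∀ {n} → Prog n → Set
NormalProg p = ∀ q → ¬ (p ⟶βf q)

NormalTerm : ∀ {n} → Term n → Set
NormalTerm {n} t = ∀ {k} (E : Env k n) → NormalProg ⟨ t , E ⟩

NormalExpr : ∀ {n} → Expr n → Set
NormalExpr (inj₁ t) = NormalTerm t
NormalExpr (inj₂ p) = NormalProg p

data CoercedVal {n} : Prog n → Set where
  coerced : ∀ {v : Term n} → Val v → CoercedVal ⟨ v , ε ⟩

ValOrCoerced : ∀ {n} → Expr n → Set
ValOrCoerced (inj₁ t) = Val t
ValOrCoerced (inj₂ p) = CoercedVal p

-- Multi types.  Multisets are represented as lists, and equality of types
-- is taken up to (deep) permutation, _≈M_.

mutual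
  data LType : Set where
    _⊸_ : MType → MType → LType

  MType : Set
  MType = List LType

𝟎 : MType
𝟎 = []

mutual
  data _≈L_ : LType → LType → Set where
    ⊸≈ : ∀ {M M' N N'} → M ≈M M' → N ≈M N' → (M ⊸ N) ≈L (M' ⊸ N')

  data _≈M_ : MType → MType → Set where
    []≈   : [] ≈M []
    ∷≈    : ∀ {L L' M M'} → L ≈L L' → M ≈M M' → (L ∷ M) ≈M (L' ∷ M')
    swap≈ : ∀ {L L' M} → (L ∷ L' ∷ M) ≈M (L' ∷ L ∷ M)
    trans≈ : ∀ {M M' M''} → M ≈M M' → M' ≈M M'' → M ≈M M''

TCtx : ℕ → Set
TCtx n = Vec MType n

_⊎ᶜ_ : ∀ {n} → TCtx n → TCtx n → TCtx n
Γ ⊎ᶜ Δ = zipWith _++_ Γ Δ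

emptyCtx : ∀ {n} → TCtx n
emptyCtx {n} = replicate n 𝟎

_∶ᶜ_ : ∀ {n} → Fin n → MType → TCtx n
x ∶ᶜ M = emptyCtx [ x ]≔ M

-- Typing rules.  (Γ , x : M) for the bound variable is  M ∷ᵥ Γ.

mutual
  data _⊢_∶_ {n} : TCtx n → Term n → MType → Set where
    ax  : ∀ (x : Fin n) (M : MType) → (x ∶ᶜ M) ⊢ var x ∶ M
    app : ∀ {Γ Δ t u M M' N} →
          Γ ⊢ t ∶ ((M ⊸ N) ∷ []) → Δ ⊢ u ∶ M' → M ≈M M' →
          (Γ ⊎ᶜ Δ) ⊢ app t u ∶ N
    lam : ∀ {Γ t Ls} → LamPremises t Γ Ls → Γ ⊢ lam t ∶ Ls

  data LamPremises {n} (t : Term (suc n)) : TCtx n → MType → Set where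
    none : LamPremises t emptyCtx []
    more : ∀ {Γ Δ M N Ls} →
           (M ∷ᵥ Γ) ⊢ t ∶ N → LamPremises t Δ Ls →
           LamPremises t (Γ ⊎ᶜ Δ) ((M ⊸ N) ∷ Ls)

data _⊢ₚ_∶_ : ∀ {n} → TCtx n → Prog n → MType → Set where
  es-ε : ∀ {n} {Γ : TCtx n} {t M} → Γ ⊢ t ∶ M → Γ ⊢ₚ ⟨ t , ε ⟩ ∶ M
  es-append : ∀ {n m} {Γ Δ : TCtx n} {t : Term m} {E : Env (suc n) m} {M M' N}
           {i : Term n} (p : Inert i) →
         (M ∷ᵥ Γ) ⊢ₚ ⟨ t , E ⟩ ∶ N → Δ ⊢ i ∶ M' → M ≈M M' →
         (Γ ⊎ᶜ Δ) ⊢ₚ ⟨ t , E ++ₑ[ i , p ] ⟩ ∶ N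

_⊢ₑ_∶_ : ∀ {n} → TCtx n → Expr n → MType → Set
Γ ⊢ₑ inj₁ t ∶ M = Γ ⊢ t ∶ M
Γ ⊢ₑ inj₂ p ∶ M = Γ ⊢ₚ p ∶ M

data InertM : MType → Set where
  []ᵢ  : InertM []
  ∷ᵢ   : ∀ {N M} → InertM N → InertM M → InertM ((𝟎 ⊸ N) ∷ M)

InertCtx : ∀ {n} → TCtx n → Set
InertCtx Γ = ∀ x → InertM (lookup Γ x)

Inert-deriv : ∀ {n} {Γ : TCtx n} {e : Expr n} {M} → Γ ⊢ₑ e ∶ M → Set
Inert-deriv {Γ = Γ} {M = M} _ = InertCtx Γ × InertM M

Tight : ∀ {n} {Γ : TCtx n} {e : Expr n} {M} → Γ ⊢ₑ e ∶ M → Set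
Tight {M = M} π = Inert-deriv π × M ≡ 𝟎

EmptyDeriv : ∀ {n} {Γ : TCtx n} {e : Expr n} {M} → Γ ⊢ₑ e ∶ M → Set
EmptyDeriv {Γ = Γ} _ = ∀ x → lookup Γ x ≡ 𝟎

-- A normal term is a fireball, and fireballs are typed by induction: a value gets type 𝟎 in
-- the context 𝟎 (for λ) or x : 𝟎 (for x), while an inert term x f₁ … fₖ can be given any inert
-- type N by typing x with [𝟎 ⊸ … [𝟎 ⊸ N] …], which puts a nonempty type on the head
-- variable. A program (t , E) is typed by adding the entries of E one by one with rule es@,
-- typing each inert entry with the inert type its variable received; if E is nonempty, its
-- outermost entry makes the context nonempty.
module Submission where

open import Defs
open import Data.Product using (Σ; ∃; _×_; _,_; proj₂)
open import Data.Nat using (suc)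
open import Data.Fin using (Fin; zero; suc; _≟_)
open import Data.List using ([]; _∷_; _++_)
open import Data.List.Properties using (++-conicalˡ; ++-conicalʳ)
open import Data.Vec using (lookup) renaming (_∷_ to _∷ᵥ_)
open import Data.Vec.Properties using (lookup-zipWith; lookup-replicate; lookup∘update; lookup∘update′)
open import Data.Sum using (inj₁; inj₂)
open import Data.Empty using (⊥-elim)
open import Function using (_∘_)
open import Relation.Nullary using (¬_; yes; no)
open import Relation.Binary.PropositionalEquality as ≡ using (_≡_; refl; sym; trans)

Everywhere : ∀ {n} → (MType → Set) → TCtx n → Set
Everywhere P Γ = ∀ x → P (lookup Γ x)

EmptyCtx : ∀ {n} → TCtx n → Set
EmptyCtx = Everywhere (_≡ 𝟎)

module _ (P : MType → Set) where

  everywhere-emptyCtx : ∀ {n} → P 𝟎 → Everywhere P (emptyCtx {n})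
  everywhere-emptyCtx P𝟎 x = ≡.subst P (sym (lookup-replicate x 𝟎)) P𝟎

  everywhere-∶ᶜ : ∀ {n} (x : Fin n) {M} → P 𝟎 → P M → Everywhere P (x ∶ᶜ M)
  everywhere-∶ᶜ x {M} P𝟎 PM y with x ≟ y
  ... | yes refl = ≡.subst P (sym (lookup∘update x emptyCtx M)) PM
  ... | no x≢y   = ≡.subst P (sym (lookup∘update′ (x≢y ∘ sym) emptyCtx M)) (everywhere-emptyCtx P𝟎 y)

  everywhere-⊎ᶜ : (∀ {M N} → P M → P N → P (M ++ N)) →
                  ∀ {n} (Γ Δ : TCtx n) → Everywhere P Γ → Everywhere P Δ → Everywhere P (Γ ⊎ᶜ Δ)
  everywhere-⊎ᶜ P-++ Γ Δ PΓ PΔ x = ≡.subst P (sym (lookup-zipWith _++_ x Γ Δ)) (P-++ (PΓ x) (PΔ x))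

emptyCtx-⊎ᶜ⁻ˡ : ∀ {n} (Γ Δ : TCtx n) → EmptyCtx (Γ ⊎ᶜ Δ) → EmptyCtx Γ
emptyCtx-⊎ᶜ⁻ˡ Γ Δ empty x = ++-conicalˡ (lookup Γ x) (lookup Δ x) (trans (sym (lookup-zipWith _++_ x Γ Δ)) (empty x))

emptyCtx-⊎ᶜ⁻ʳ : ∀ {n} (Γ Δ : TCtx n) → EmptyCtx (Γ ⊎ᶜ Δ) → EmptyCtx Δ
emptyCtx-⊎ᶜ⁻ʳ Γ Δ empty x = ++-conicalʳ (lookup Γ x) (lookup Δ x) (trans (sym (lookup-zipWith _++_ x Γ Δ)) (empty x))

∶ᶜ-nonempty : ∀ {n} (x : Fin n) L M → ¬ EmptyCtx (x ∶ᶜ (L ∷ M))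
∶ᶜ-nonempty x L M empty with trans (sym (lookup∘update x emptyCtx (L ∷ M))) (empty x)
... | ()

InertM-++ : ∀ {M N} → InertM M → InertM N → InertM (M ++ N)
InertM-++ []ᵢ        N = N
InertM-++ (∷ᵢ L M) N = ∷ᵢ L (InertM-++ M N)

inertCtx-⊎ᶜ : ∀ {n} (Γ Δ : TCtx n) → InertCtx Γ → InertCtx Δ → InertCtx (Γ ⊎ᶜ Δ)
inertCtx-⊎ᶜ = everywhere-⊎ᶜ InertM InertM-++

mutual
  ≈L-refl : ∀ L → L ≈L L
  ≈L-refl (M ⊸ N) = ⊸≈ (≈M-refl M) (≈M-refl N)

  ≈M-refl : ∀ M → M ≈M M
  ≈M-refl []      = []≈
  ≈M-refl (L ∷ M) = ∷≈ (≈L-refl L) (≈M-refl M)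

TightTyping : ∀ {n} → Expr n → Set
TightTyping {n} e = Σ (TCtx n) λ Γ → (Γ ⊢ₑ e ∶ 𝟎) × InertCtx Γ ×
                    (ValOrCoerced e → EmptyCtx Γ) × (EmptyCtx Γ → ValOrCoerced e)

inert-not-val : ∀ {n} {t : Term n} → Inert t → ¬ Val t
inert-not-val (head _ _) ()
inert-not-val (more _ _) ()

mutual
  inert-typing : ∀ {n} {i : Term n} → Inert i → ∀ {N} → InertM N →
                 Σ (TCtx n) λ Γ → (Γ ⊢ i ∶ N) × InertCtx Γ × ¬ EmptyCtx Γ
  inert-typing (head x f) {N} inertN with fireball-typing f
  ... | Δ , πf , inertΔ , _ =
    Γ ⊎ᶜ Δ , app (ax x _) πf []≈ ,
    inertCtx-⊎ᶜ Γ Δ (everywhere-∶ᶜ InertM x []ᵢ (∷ᵢ inertN []ᵢ)) inertΔ ,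
    λ empty → ∶ᶜ-nonempty x _ [] (emptyCtx-⊎ᶜ⁻ˡ Γ Δ empty)
    where Γ = x ∶ᶜ ((𝟎 ⊸ N) ∷ [])
  inert-typing (more i f) inertN with inert-typing i (∷ᵢ inertN []ᵢ) | fireball-typing f
  ... | Γ , πi , inertΓ , nonempty | Δ , πf , inertΔ , _ =
    Γ ⊎ᶜ Δ , app πi πf []≈ , inertCtx-⊎ᶜ Γ Δ inertΓ inertΔ ,
    λ empty → nonempty (emptyCtx-⊎ᶜ⁻ˡ Γ Δ empty)

  fireball-typing : ∀ {n} {f : Term n} → Fire f → TightTyping (inj₁ f)
  fireball-typing (val (var x)) =
    x ∶ᶜ 𝟎 , ax x 𝟎 , everywhere-∶ᶜ InertM x []ᵢ []ᵢ ,
    (λ _ → everywhere-∶ᶜ (_≡ 𝟎) x refl refl) , (λ _ → var x)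
  fireball-typing (val (lam t)) =
    emptyCtx , lam none , everywhere-emptyCtx InertM []ᵢ ,
    (λ _ → everywhere-emptyCtx (_≡ 𝟎) refl) , (λ _ → lam t)
  fireball-typing (inert i) with inert-typing i []ᵢ
  ... | Γ , πi , inertΓ , nonempty =
    Γ , πi , inertΓ , (λ v → ⊥-elim (inert-not-val i v)) , (λ empty → ⊥-elim (nonempty empty))

step-under-appL : ∀ {k n} {E : Env k n} (t : Term n) {u q} → ⟨ u , E ⟩ ⟶βf q →
                  ∃ λ q′ → ⟨ app t u , E ⟩ ⟶βf q′
step-under-appL t (inj₁ (βv C v)) = _ , inj₁ (βv (appL t C) v)
step-under-appL t (inj₂ (βi C i)) = _ , inj₂ (βi (appL t C) i)

step-under-appR : ∀ {k n} {E : Env k n} {u : Term n} → Fire u → ∀ {t q} → ⟨ t , E ⟩ ⟶βf q →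
                  ∃ λ q′ → ⟨ app t u , E ⟩ ⟶βf q′
step-under-appR f (inj₁ (βv C v)) = _ , inj₁ (βv (appR C f) v)
step-under-appR f (inj₂ (βi C i)) = _ , inj₂ (βi (appR C f) i)

normal⇒fireball : ∀ {k n} {E : Env k n} (t : Term n) → NormalProg ⟨ t , E ⟩ → Fire t
normal⇒fireball (var x) _ = val (var x)
normal⇒fireball (lam t) _ = val (lam t)
normal⇒fireball (app t u) normal
  with normal⇒fireball u (λ _ step → normal _ (proj₂ (step-under-appL t step)))
... | fu with normal⇒fireball t (λ _ step → normal _ (proj₂ (step-under-appR fu step)))
...   | val (var x) = inert (head x fu)
...   | inert i     = inert (more i fu)
...   | val (lam s) with fu
...     | val v   = ⊥-elim (normal _ (inj₁ (βv hole v)))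
...     | inert i = ⊥-elim (normal _ (inj₂ (βi hole i)))

data SnocView {n} : ∀ {m} → Env n m → Set where
  ε    : SnocView ε
  _∷ʳ_ : ∀ {m} {E : Env (suc n) m} → SnocView E → ∀ {i} (p : Inert i) → SnocView (E ++ₑ[ i , p ])

snocView-cons : ∀ {n m} {i : Term m} (p : Inert i) {E : Env n m} → SnocView E → SnocView (cons i p E)
snocView-cons p ε         = ε ∷ʳ p
snocView-cons p (E ∷ʳ p′) = snocView-cons p E ∷ʳ p′

snocView : ∀ {n m} (E : Env n m) → SnocView E
snocView ε            = ε
snocView (cons i p E) = snocView-cons p (snocView E)

appended-not-coerced : ∀ {n m} {t : Term m} (E : Env (suc n) m) {i} (p : Inert i) →
                       ¬ CoercedVal ⟨ t , E ++ₑ[ i , p ] ⟩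
appended-not-coerced ε            p ()
appended-not-coerced (cons _ _ _) p ()

program-typing : ∀ {n m} {t : Term m} {E : Env n m} → SnocView E →
                 TightTyping (inj₁ t) → TightTyping (inj₂ ⟨ t , E ⟩)
program-typing ε (Γ , π , inertΓ , val⇒empty , empty⇒val) =
  Γ , es-ε π , inertΓ , (λ { (coerced v) → val⇒empty v }) , (λ empty → coerced (empty⇒val empty))
program-typing (_∷ʳ_ {E = E} view p) typing with program-typing view typing
... | M ∷ᵥ Γ , π , inertMΓ , _ with inert-typing p (inertMΓ zero)
...   | Δ , πi , inertΔ , nonempty =
  Γ ⊎ᶜ Δ , es-append p π πi (≈M-refl M) , inertCtx-⊎ᶜ Γ Δ (λ x → inertMΓ (suc x)) inertΔ ,
  (λ coerced → ⊥-elim (appended-not-coerced E p coerced)) ,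
  (λ empty → ⊥-elim (nonempty (emptyCtx-⊎ᶜ⁻ʳ Γ Δ empty)))

normal⇒tightTyping : ∀ {n} (e : Expr n) → NormalExpr e → TightTyping e
normal⇒tightTyping (inj₁ t)         normal = fireball-typing (normal⇒fireball t (normal ε))
normal⇒tightTyping (inj₂ ⟨ t , E ⟩) normal =
  program-typing (snocView E) (fireball-typing (normal⇒fireball t normal))

proposition10 : ∀ {n} (e : Expr n) → NormalExpr e →
    Σ (TCtx n) λ Γ → Σ (Γ ⊢ₑ e ∶ 𝟎) λ π →
      Tight {e = e} π × ((ValOrCoerced e → EmptyDeriv {e = e} π) × (EmptyDeriv {e = e} π → ValOrCoerced e))
proposition10 e normal with normal⇒tightTyping e normal
... | Γ , π , inertΓ , val⇒empty , empty⇒val = Γ , π , ((inertΓ , []ᵢ) , refl) , val⇒empty , empty⇒val
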